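{- Let $\mu$ be the morphism on $\{0,1\}^*$ defined by $\mu(0)=01$, $\mu(1)=10$, and let $\mathbf{TM}_0=t_0t_1t_2\cdots$ be the fixed point of $\mu$ beginning with $0$ (the Thue--Morse word). Then for every $n\ge 0$ and every integer $k\ge 2$, the suffix $t_nt_{n+1}t_{n+2}\cdots$ of $\mathbf{TM}_0$ has a prefix that is an Abelian $k$-power.
   Context: For a finite word $x$ over an alphabet $A=\{a_1,\dots,a_m\}$, $|x|_b$ denotes the number of occurrences of the letter $b$ in $x$, and the Parikh vector of $x$ is $\Psi(x)=(|x|_{a_1},\dots,|x|_{a_m})$. Two words are Abelian equivalent if they have the same Parikh vector. For an integer $k\ge 2$, a nonempty word $w$ is an Abelian $k$-power if $w=u_1u_2\cdots u_k$ with $u_1,\dots,u_k$ pairwise Abelian equivalent; $|u_1|$ is called its period. -}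

module Defs where

open import Data.Bool using (Bool; true; false; not; _≟_)
open import Relation.Nullary using (yes; no)
open import Data.Nat using (ℕ; zero; suc; _+_; _<_; _≥_)
open import Data.List using (List; []; _∷_; _++_; concatMap; length; map; upTo; concat; filter; replicate)
open import Data.List.Relation.Unary.All using (All)
open import Data.Product using (Σ; _×_; ∃-syntax)
open import Relation.Binary.PropositionalEquality using (_≡_; _≢_)

-- Binary alphabet {0,1}: 0 is false, 1 is true.

μ : List Bool → List Bool
μ = concatMap (λ b → b ∷ not b ∷ [])

μ^ : ℕ → List Bool → List Bool
μ^ zero    w = w
μ^ (suc n) w = μ (μ^ n w)

-- i-th letter of a finite word, with a default (unused in our application)
index : List Bool → ℕ → Bool
index []       _       = false
index (b ∷ _)  zero    = b
index (_ ∷ w)  (suc i) = index w i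

-- The fixed point TM₀ = t₀t₁t₂⋯ of μ starting with 0, as an infinite word:
-- μ^m(0) is a prefix of TM₀ of length 2^m, so t_n is the n-th letter of μ^(n+1)(0)
-- (which has length 2^(n+1) > n).
t : ℕ → Bool
t n = index (μ^ (suc n) (false ∷ [])) n

count : Bool → List Bool → ℕ
count b []      = 0
count b (c ∷ x) with b ≟ c
... | yes _ = suc (count b x)
... | no  _ = count b x

Ψ : List Bool → ℕ × ℕ
Ψ x = count false x Data.Product., count true x

_∼ₐ_ : List Bool → List Bool → Set
x ∼ₐ y = Ψ x ≡ Ψ y

data Pairwise∼ : List (List Bool) → Set where
  []  : Pairwise∼ []
  _∷_ : ∀ {u us} → All (λ v → u ∼ₐ v) us → Pairwise∼ us → Pairwise∼ (u ∷ us)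

AbelianPower : ℕ → List Bool → Set
AbelianPower k w =
  (w ≢ []) ×
  ∃[ us ] (length us ≡ k × concat us ≡ w × Pairwise∼ us)

suffixPrefix : ℕ → ℕ → List Bool
suffixPrefix n L = map (λ i → t (n + i)) (upTo L)

module Submission where

-- From μ one derives the recurrences t(2i) = t(i) and
-- t(2i+1) = ¬t(i), and from them the block identity
-- t(a + 2^J·b) = t(a) xor t(b) for a < 2^J.  A factor of even length 2p
-- starting at an even position is a product of p pairs x·¬x, hence has
-- Parikh vector (p , p).
--   * n = 2m: the k consecutive factors of length 2 starting at n are such
--     pairs, so the prefix of length 2k is an Abelian k-power.
--   * n = 2m+1: take p = 2^m·(1 + 2^k).  The factor of length 2p starting at
--     the odd position 2q+1 is Abelian equivalent to the one at 2q as soon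
--     as t(2q) = t(2q+2p), i.e. t(q) = t(q+p).  For q = m + i·p the block
--     identity gives t(m + i·p) = t(m) xor t(i) xor t(i) = t(m) for i ≤ k,
--     so the k factors of length 2p starting at n all have vector (p , p).

open import Defs
open import Data.Nat using (ℕ; _≥_)
open import Data.Product using (∃-syntax)

open import Data.Bool using (Bool; true; false; not; _xor_; _≟_)
open import Data.Bool.Properties using (xor-same; xor-identityʳ; not-distribˡ-xor)
open import Data.List using (List; []; _∷_; _++_; length; concat; applyUpTo)
open import Data.List.Properties using (map-applyUpTo; ++-assoc; ++-identityʳ)
open import Data.List.Relation.Unary.All using (All; []; _∷_)
open import Data.Nat using (zero; suc; _+_; _*_; _^_; _∸_; _≤_; _<_; z≤n; s≤s)
open import Data.Nat.Properties
  using (+-identityʳ; +-suc; +-comm; +-assoc; +-mono-≤; +-cancelˡ-≡; *-assoc; *-suc; *-mono-≤;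
         m^n>0; m∸n+n≡m; ≤-total; ≤-trans; <-trans; ≤-<-trans; <⇒≤; n<1+n; module ≤-Reasoning)
open import Data.Nat.Solver using (module +-*-Solver)
open import Data.Product using (Σ; _,_)
open import Data.Sum using (inj₁; inj₂)
open import Relation.Binary.PropositionalEquality
open import Relation.Nullary using (yes; no)

open +-*-Solver using (solve; _:+_; _:*_; _:=_; con)

-- Doubling, defined by recursion so that indices 2i, 2i+1 compute on lists.
double : ℕ → ℕ
double zero    = zero
double (suc n) = suc (suc (double n))

double≡2* : ∀ n → double n ≡ 2 * n
double≡2* zero    = refl
double≡2* (suc n) = trans (cong (λ x → suc (suc x)) (double≡2* n)) (sym (*-suc 2 n))

double-+ : ∀ a b → double (a + b) ≡ double a + double b
double-+ zero    b = refl
double-+ (suc a) b = cong (λ x → suc (suc x)) (double-+ a b)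

double-mono-< : ∀ {i L} → i < L → suc (double i) < double L
double-mono-< {zero}  {suc L} _       = s≤s (s≤s z≤n)
double-mono-< {suc i} {suc L} (s≤s p) = s≤s (s≤s (double-mono-< p))

double-cancel-< : ∀ {x y} → double x < double y → x < y
double-cancel-< {zero}  {suc y} _               = s≤s z≤n
double-cancel-< {suc x} {suc y} (s≤s (s≤s p)) = s≤s (double-cancel-< p)

data Parity : ℕ → Set where
  even : ∀ x → Parity (double x)
  odd  : ∀ x → Parity (suc (double x))

parity : ∀ a → Parity a
parity zero = even zero
parity (suc a) with parity a
... | even x = odd x
... | odd x  = even (suc x)

n<2^n : ∀ n → n < 2 ^ n
n<2^n zero    = s≤s z≤n
n<2^n (suc n) = begin
  suc (suc n)   ≡⟨ +-comm 1 (suc n) ⟩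
  suc n + 1     ≤⟨ +-mono-≤ (n<2^n n) (m^n>0 2 n) ⟩
  2 ^ n + 2 ^ n ≡⟨ cong (2 ^ n +_) (sym (+-identityʳ (2 ^ n))) ⟩
  2 ^ suc n     ∎
  where open ≤-Reasoning

W : ℕ → List Bool
W n = μ^ n (false ∷ [])

μ-++ : ∀ x y → μ (x ++ y) ≡ μ x ++ μ y
μ-++ []      y = refl
μ-++ (b ∷ x) y = cong (λ z → b ∷ not b ∷ z) (μ-++ x y)

length-μ : ∀ w → length (μ w) ≡ double (length w)
length-μ []      = refl
length-μ (b ∷ w) = cong (λ x → suc (suc x)) (length-μ w)

length-W : ∀ n → length (W n) ≡ 2 ^ n
length-W zero    = refl
length-W (suc n) = trans (length-μ (W n)) (trans (cong double (length-W n)) (double≡2* (2 ^ n)))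

-- W n is a prefix of W (suc n): W(n+1) = μⁿ(01) = W n · μⁿ(1).
W-extends : ∀ n → Σ (List Bool) λ r → W n ++ r ≡ W (suc n)
W-extends zero = true ∷ [] , refl
W-extends (suc n) with W-extends n
... | r , e = μ r , trans (sym (μ-++ (W n) r)) (cong μ e)

W-prefix : ∀ n j → Σ (List Bool) λ r → W n ++ r ≡ W (j + n)
W-prefix n zero = [] , ++-identityʳ (W n)
W-prefix n (suc j) with W-prefix n j | W-extends (j + n)
... | r , e | r' , e' = r ++ r' , trans (sym (++-assoc (W n) r r')) (trans (cong (_++ r') e) e')

index-++ : ∀ w r {i} → i < length w → index (w ++ r) i ≡ index w i
index-++ (b ∷ w) r {zero}  _       = refl
index-++ (b ∷ w) r {suc i} (s≤s p) = index-++ w r p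

index-W-stable : ∀ {m n i} → m ≤ n → i < length (W m) → index (W n) i ≡ index (W m) i
index-W-stable {m} {n} {i} m≤n i<len with W-prefix m (n ∸ m)
... | r , e = trans (cong (λ w → index w i) (trans (cong W (sym (m∸n+n≡m m≤n))) (sym e)))
                    (index-++ (W m) r i<len)

i<length-W : ∀ i → i < length (W i)
i<length-W i = subst (i <_) (sym (length-W i)) (n<2^n i)

t-from-W : ∀ n {i} → i < length (W n) → t i ≡ index (W n) i
t-from-W n {i} i<len with ≤-total n (suc i)
... | inj₁ n≤ = index-W-stable n≤ i<len
... | inj₂ ≤n = sym (index-W-stable ≤n (<-trans (n<1+n i)
                      (subst (suc i <_) (sym (length-W (suc i))) (n<2^n (suc i)))))

index-μ-even : ∀ w {i} → i < length w → index (μ w) (double i) ≡ index w i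
index-μ-even (b ∷ w) {zero}  _       = refl
index-μ-even (b ∷ w) {suc i} (s≤s p) = index-μ-even w p

index-μ-odd : ∀ w {i} → i < length w → index (μ w) (suc (double i)) ≡ not (index w i)
index-μ-odd (b ∷ w) {zero}  _       = refl
index-μ-odd (b ∷ w) {suc i} (s≤s p) = index-μ-odd w p

t-double : ∀ i → t (double i) ≡ t i
t-double i = begin
  t (double i)                   ≡⟨ t-from-W (suc i) 2i<len ⟩
  index (μ (W i)) (double i)     ≡⟨ index-μ-even (W i) (i<length-W i) ⟩
  index (W i) i                  ≡⟨ sym (t-from-W i (i<length-W i)) ⟩
  t i                            ∎
  where
  open ≡-Reasoning
  2i<len : double i < length (W (suc i))
  2i<len = subst (double i <_) (sym (length-μ (W i)))
                 (<-trans (n<1+n _) (double-mono-< (i<length-W i)))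

t-suc-double : ∀ i → t (suc (double i)) ≡ not (t i)
t-suc-double i = begin
  t (suc (double i))                 ≡⟨ t-from-W (suc i) 2i+1<len ⟩
  index (μ (W i)) (suc (double i))   ≡⟨ index-μ-odd (W i) (i<length-W i) ⟩
  not (index (W i) i)                ≡⟨ cong not (sym (t-from-W i (i<length-W i))) ⟩
  not (t i)                          ∎
  where
  open ≡-Reasoning
  2i+1<len : suc (double i) < length (W (suc i))
  2i+1<len = subst (suc (double i) <_) (sym (length-μ (W i))) (double-mono-< (i<length-W i))

2^suc-*≡double : ∀ J b → 2 ^ suc J * b ≡ double (2 ^ J * b)
2^suc-*≡double J b = trans (*-assoc 2 (2 ^ J) b) (sym (double≡2* (2 ^ J * b)))

double-shift : ∀ J x b → double x + 2 ^ suc J * b ≡ double (x + 2 ^ J * b)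
double-shift J x b = trans (cong (double x +_) (2^suc-*≡double J b)) (sym (double-+ x (2 ^ J * b)))

t-block : ∀ J a b → a < 2 ^ J → t (a + 2 ^ J * b) ≡ t a xor t b
t-block zero    zero    b _ = cong t (+-identityʳ b)
t-block zero    (suc a) b (s≤s ())
t-block (suc J) a       b a<2^J+1 with parity a | subst (a <_) (sym (double≡2* (2 ^ J))) a<2^J+1
... | even x | 2x<2^J+1 = begin
  t (double x + 2 ^ suc J * b)      ≡⟨ cong t (double-shift J x b) ⟩
  t (double (x + 2 ^ J * b))        ≡⟨ t-double (x + 2 ^ J * b) ⟩
  t (x + 2 ^ J * b)                 ≡⟨ t-block J x b (double-cancel-< 2x<2^J+1) ⟩
  t x xor t b                       ≡⟨ cong (_xor t b) (sym (t-double x)) ⟩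
  t (double x) xor t b              ∎
  where open ≡-Reasoning
... | odd x | 2x+1<2^J+1 = begin
  t (suc (double x) + 2 ^ suc J * b)  ≡⟨ cong (λ c → t (suc c)) (double-shift J x b) ⟩
  t (suc (double (x + 2 ^ J * b)))    ≡⟨ t-suc-double (x + 2 ^ J * b) ⟩
  not (t (x + 2 ^ J * b))             ≡⟨ cong not (t-block J x b (half-bound 2x+1<2^J+1)) ⟩
  not (t x xor t b)                   ≡⟨ not-distribˡ-xor (t x) (t b) ⟩
  not (t x) xor t b                   ≡⟨ cong (_xor t b) (sym (t-suc-double x)) ⟩
  t (suc (double x)) xor t b          ∎
  where
  open ≡-Reasoning
  half-bound : suc (double x) < double (2 ^ J) → x < 2 ^ J
  half-bound p = double-cancel-< (<-trans (n<1+n _) p)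

-- t(m + i·2^m(1 + 2^k)) = t(m) for all i ≤ k: along this progression the
-- Thue–Morse word is constant, since t(i + 2^k·i) = t(i) xor t(i) = 0.
t-progression : ∀ m k i → i ≤ k → t (m + i * (2 ^ m * (1 + 2 ^ k))) ≡ t m
t-progression m k i i≤k = begin
  t (m + i * (2 ^ m * (1 + 2 ^ k)))   ≡⟨ cong (λ c → t (m + c)) (regroup i (2 ^ m) (2 ^ k)) ⟩
  t (m + 2 ^ m * (i + 2 ^ k * i))     ≡⟨ t-block m m (i + 2 ^ k * i) (n<2^n m) ⟩
  t m xor t (i + 2 ^ k * i)           ≡⟨ cong (t m xor_) (t-block k i i (≤-<-trans i≤k (n<2^n k))) ⟩
  t m xor (t i xor t i)               ≡⟨ cong (t m xor_) (xor-same (t i)) ⟩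
  t m xor false                       ≡⟨ xor-identityʳ (t m) ⟩
  t m                                 ∎
  where
  open ≡-Reasoning
  regroup : ∀ i a b → i * (a * (1 + b)) ≡ a * (i + b * i)
  regroup = solve 3 (λ i a b → i :* (a :* (con 1 :+ b)) := a :* (i :+ b :* i)) refl

factor : ℕ → ℕ → List Bool
factor a zero    = []
factor a (suc L) = t a ∷ factor (suc a) L

suffixPrefix≡factor : ∀ n L → suffixPrefix n L ≡ factor n L
suffixPrefix≡factor n L = trans (map-applyUpTo (λ i → i) (λ i → t (n + i)) L) (tabulated _ n L (λ i → refl))
  where
  tabulated : ∀ f a L → (∀ i → f i ≡ t (a + i)) → applyUpTo f L ≡ factor a L
  tabulated f a zero    _  = refl
  tabulated f a (suc L) fi = cong₂ _∷_ (trans (fi 0) (cong t (+-identityʳ a)))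
    (tabulated (λ i → f (suc i)) (suc a) L (λ i → trans (fi (suc i)) (cong t (+-suc a i))))

factor-++ : ∀ a B L → factor a (B + L) ≡ factor a B ++ factor (a + B) L
factor-++ a zero    L = cong (λ c → factor c L) (sym (+-identityʳ a))
factor-++ a (suc B) L = cong (t a ∷_) (trans (factor-++ (suc a) B L)
                          (cong (λ c → factor (suc a) B ++ factor c L) (sym (+-suc a B))))

factor-snoc : ∀ a L → factor a (suc L) ≡ factor a L ++ (t (a + L) ∷ [])
factor-snoc a L = trans (cong (factor a) (+-comm 1 L)) (factor-++ a L 1)

count-++ : ∀ b x y → count b (x ++ y) ≡ count b x + count b y
count-++ b []      y = refl
count-++ b (c ∷ x) y with b ≟ c
... | yes _ = cong suc (count-++ b x y)
... | no  _ = count-++ b x y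

count-pair : ∀ b x w → count b (x ∷ not x ∷ w) ≡ suc (count b w)
count-pair false false w = refl
count-pair false true  w = refl
count-pair true  false w = refl
count-pair true  true  w = refl

Balanced : ℕ → List Bool → Set
Balanced p w = ∀ b → count b w ≡ p

Balanced⇒Ψ : ∀ {p} w → Balanced p w → Ψ w ≡ (p , p)
Balanced⇒Ψ w bal = cong₂ _,_ (bal false) (bal true)

-- A factor of length 2p at an even position is p pairs t(2j)t(2j+1) = x·¬x.
even-factor-balanced : ∀ q p → Balanced p (factor (double q) (double p))
even-factor-balanced q zero    b = refl
even-factor-balanced q (suc p) b = begin
  count b (t (double q) ∷ t (suc (double q)) ∷ rest)
      ≡⟨ cong₂ (λ x y → count b (x ∷ y ∷ rest)) (t-double q) (t-suc-double q) ⟩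
  count b (t q ∷ not (t q) ∷ rest)   ≡⟨ count-pair b (t q) rest ⟩
  suc (count b rest)                 ≡⟨ cong suc (even-factor-balanced (suc q) p b) ⟩
  suc p                              ∎
  where
  open ≡-Reasoning
  rest : List Bool
  rest = factor (double (suc q)) (double p)

count-shift : ∀ b a L → t a ≡ t (a + L) → count b (factor (suc a) L) ≡ count b (factor a L)
count-shift b a L same = +-cancelˡ-≡ (count b (t a ∷ [])) _ _ (begin
  count b (t a ∷ []) + count b (factor (suc a) L)   ≡⟨ sym (count-++ b (t a ∷ []) _) ⟩
  count b (factor a (suc L))                         ≡⟨ cong (count b) (factor-snoc a L) ⟩
  count b (factor a L ++ (t (a + L) ∷ []))           ≡⟨ count-++ b (factor a L) _ ⟩
  count b (factor a L) + count b (t (a + L) ∷ [])    ≡⟨ cong (λ x → count b (factor a L) + count b (x ∷ [])) (sym same) ⟩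
  count b (factor a L) + count b (t a ∷ [])          ≡⟨ +-comm (count b (factor a L)) _ ⟩
  count b (t a ∷ []) + count b (factor a L)          ∎)
  where open ≡-Reasoning

odd-factor-balanced : ∀ q p → t q ≡ t (q + p) → Balanced p (factor (suc (double q)) (double p))
odd-factor-balanced q p same b = trans (count-shift b (double q) (double p) ends-agree)
                                       (even-factor-balanced q p b)
  where
  ends-agree : t (double q) ≡ t (double q + double p)
  ends-agree = trans (t-double q) (trans same (trans (sym (t-double (q + p)))
                 (cong t (double-+ q p))))

blocks : ℕ → ℕ → ℕ → List (List Bool)
blocks a B zero    = []
blocks a B (suc k) = factor a B ∷ blocks (a + B) B k

length-blocks : ∀ a B k → length (blocks a B k) ≡ k
length-blocks a B zero    = refl
length-blocks a B (suc k) = cong suc (length-blocks (a + B) B k)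

concat-blocks : ∀ a B k → concat (blocks a B k) ≡ factor a (k * B)
concat-blocks a B zero    = refl
concat-blocks a B (suc k) = trans (cong (factor a B ++_) (concat-blocks (a + B) B k))
                                  (sym (factor-++ a B (k * B)))

all-blocks : ∀ a B k v → (∀ i → i < k → Ψ (factor (a + i * B) B) ≡ v) →
             All (λ u → Ψ u ≡ v) (blocks a B k)
all-blocks a B zero    v h = []
all-blocks a B (suc k) v h =
  subst (λ c → Ψ (factor c B) ≡ v) (+-identityʳ a) (h 0 (s≤s z≤n)) ∷
  all-blocks (a + B) B k v (λ i i<k →
    subst (λ c → Ψ (factor c B) ≡ v) (sym (+-assoc a B (i * B))) (h (suc i) (s≤s i<k)))

same-Ψ⇒Pairwise∼ : ∀ v us → All (λ u → Ψ u ≡ v) us → Pairwise∼ us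
same-Ψ⇒Pairwise∼ v []       []       = []
same-Ψ⇒Pairwise∼ v (u ∷ us) (p ∷ ps) = equiv-to-u us ps ∷ same-Ψ⇒Pairwise∼ v us ps
  where
  equiv-to-u : ∀ ws → All (λ w → Ψ w ≡ v) ws → All (λ w → u ∼ₐ w) ws
  equiv-to-u []       []       = []
  equiv-to-u (w ∷ ws) (q ∷ qs) = trans p (sym q) ∷ equiv-to-u ws qs

equal-blocks⇒AbelianPower : ∀ n B k v → 0 < B → 0 < k →
  (∀ i → i < k → Ψ (factor (n + i * B) B) ≡ v) → AbelianPower k (suffixPrefix n (k * B))
equal-blocks⇒AbelianPower n (suc B) (suc k) v _ _ h rewrite suffixPrefix≡factor n (suc k * suc B) =
  (λ ()) , blocks n (suc B) (suc k) , length-blocks n (suc B) (suc k) ,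
  concat-blocks n (suc B) (suc k) , same-Ψ⇒Pairwise∼ v _ (all-blocks n (suc B) (suc k) v h)

double-affine : ∀ m i p → double (m + i * p) ≡ double m + i * double p
double-affine m i p = begin
  double (m + i * p)          ≡⟨ double-+ m (i * p) ⟩
  double m + double (i * p)   ≡⟨ cong (double m +_) (double≡2* (i * p)) ⟩
  double m + 2 * (i * p)      ≡⟨ cong (double m +_) (regroup i p) ⟩
  double m + i * (2 * p)      ≡⟨ cong (λ c → double m + i * c) (sym (double≡2* p)) ⟩
  double m + i * double p     ∎
  where
  open ≡-Reasoning
  regroup : ∀ i p → 2 * (i * p) ≡ i * (2 * p)
  regroup = solve 2 (λ i p → con 2 :* (i :* p) := i :* (con 2 :* p)) refl

even-start-blocks : ∀ m i → Ψ (factor (double m + i * 2) 2) ≡ (1 , 1)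
even-start-blocks m i = subst (λ a → Ψ (factor a 2) ≡ (1 , 1)) (double-affine m i 1)
                              (Balanced⇒Ψ (factor (double (m + i * 1)) 2) (even-factor-balanced (m + i * 1) 1))

odd-half-period : ℕ → ℕ → ℕ
odd-half-period m k = 2 ^ m * (1 + 2 ^ k)

odd-half-period>0 : ∀ m k → 0 < odd-half-period m k
odd-half-period>0 m k = *-mono-≤ (m^n>0 2 m) (s≤s z≤n)

-- Odd start n = 2m+1: for i < k the i-th block of length 2p starts at 2q+1
-- with q = m + i·p, and t(q) = t(m) = t(q + p) by t-progression.
odd-start-blocks : ∀ m k i → i < k →
  Ψ (factor (suc (double m) + i * double (odd-half-period m k)) (double (odd-half-period m k)))
    ≡ (odd-half-period m k , odd-half-period m k)
odd-start-blocks m k i i<k =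
  subst (λ a → Ψ (factor a (double p)) ≡ (p , p)) (cong suc (double-affine m i p))
        (Balanced⇒Ψ (factor (suc (double (m + i * p))) (double p)) (odd-factor-balanced (m + i * p) p ends-agree))
  where
  p : ℕ
  p = odd-half-period m k
  next-start : m + i * p + p ≡ m + suc i * p
  next-start = trans (+-assoc m (i * p) p) (cong (m +_) (+-comm (i * p) p))
  ends-agree : t (m + i * p) ≡ t (m + i * p + p)
  ends-agree = trans (t-progression m k i (<⇒≤ i<k))
                     (sym (trans (cong t next-start) (t-progression m k (suc i) i<k)))

mainTheorem1 : (n k : ℕ) → k ≥ 2 → ∃[ L ] AbelianPower k (suffixPrefix n L)
mainTheorem1 n k k≥2 with parity n | ≤-trans (s≤s z≤n) k≥2
... | even m | k>0 = k * 2 ,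
  equal-blocks⇒AbelianPower (double m) 2 k (1 , 1) (s≤s z≤n) k>0 (λ i _ → even-start-blocks m i)
... | odd m  | k>0 = k * double p ,
  equal-blocks⇒AbelianPower (suc (double m)) (double p) k (p , p) 2p>0 k>0 (odd-start-blocks m k)
  where
  p : ℕ
  p = odd-half-period m k
  2p>0 : 0 < double p
  2p>0 = <-trans (s≤s z≤n) (double-mono-< (odd-half-period>0 m k))
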